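{- Every normal, almost closed typed term of type $\mathbf L(\tau)$, $\mathbf B$ or $\Diamond$ is a list, $\mathsf{tt}$ or $\mathsf{ff}$, or a variable of type $\Diamond$, respectively.
   Context: Linear types are generated by $\rho,\tau ::= \Diamond \mid \mathbf{B} \mid \tau\multimap\rho \mid \tau\otimes\rho \mid \tau\times\rho \mid \mathbf{L}(\tau)$. There are infinitely many variables of each type; $x^\tau$ denotes a variable $x$ of type $\tau$. Raw terms are $r,s,t ::= x^\tau \mid c \mid \lambda x^\tau.t \mid \langle t,s\rangle \mid t s \mid \{t\}$, where the constants $c$ are $\mathsf{tt},\mathsf{ff}$ of type $\mathbf B$, $\mathsf{nil}_\tau$ of type $\mathbf L(\tau)$, $\mathsf{cons}_\tau$ of type $\Diamond\multimap\tau\multimap\mathbf L(\tau)\multimap\mathbf L(\tau)$, and $\otimes_{\tau,\rho}$ of type $\tau\multimap\rho\multimap\tau\otimes\rho$. Application associates to the left, $\lambda x,y.t$ abbreviates $\lambda x.\lambda y.t$, $\alpha$-equivalent terms are identified, and $t[s/x]$ is capture-avoiding substitution ($t[s,r/x,y]$ simultaneous). A context is a finite set of variables; $\Gamma_1,\Gamma_2$ denotes $\Gamma_1\cup\Gamma_2$ where these are disjoint. The typing relation $\Gamma\vdash t:\tau$ is inductively defined by: (Var) $\Gamma,x^\tau\vdash x:\tau$; (Const) $\Gamma\vdash c:\tau$ if $c$ has type $\tau$; ($\multimap^+$) from $\Gamma\cup\{x^\tau\}\vdash t:\rho$ infer $\Gamma\vdash\lambda x^\tau.t:\tau\multimap\rho$;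 ($\multimap^-$) from $\Gamma_1\vdash t:\tau\multimap\rho$ and $\Gamma_2\vdash s:\tau$ infer $\Gamma_1,\Gamma_2\vdash ts:\rho$; ($\times^+$) from $\Gamma\vdash t:\tau$ and $\Gamma\vdash s:\rho$ infer $\Gamma\vdash\langle t,s\rangle:\tau\times\rho$; ($\times^-$) from $\Gamma\vdash t:\tau\times\rho$ infer $\Gamma\vdash t\,\mathsf{tt}:\tau$ and $\Gamma\vdash t\,\mathsf{ff}:\rho$; ($\mathbf B^-$) from $\Gamma_1\vdash t:\mathbf B$, $\Gamma_2\vdash s:\tau$, $\Gamma_2\vdash r:\tau$ infer $\Gamma_1,\Gamma_2\vdash t\langle s,r\rangle:\tau$; ($\otimes^-$) from $\Gamma_1\vdash t:\tau\otimes\rho$ and $\Gamma_2,x^\tau,y^\rho\vdash s:\sigma$ infer $\Gamma_1,\Gamma_2\vdash t(\lambda x^\tau,y^\rho.s):\sigma$; ($\mathbf L^-$) from $\Gamma\vdash t:\mathbf L(\tau)$ and $\emptyset\vdash s:\Diamond\multimap\tau\multimap\rho\multimap\rho$ infer $\Gamma\vdash t\{s\}:\rho\multimap\rho$. A list (with $n$ entries) is a term $\mathsf{cons}_\tau d_1 a_1(\cdots(\mathsf{cons}_\tau d_n a_n\,\mathsf{nil}_\tau))$ where the $d_i$ are terms typable with type $\Diamond$ and the $a_i$ terms typable with type $\tau$. Conversions $\mapsto$: $(\lambda x.t)s\mapsto t[s/x]$; $\langle t,s\rangle\mathsf{tt}\mapsto t$; $\langle t,s\rangle\mathsf{ff}\mapsto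 s$; $\mathsf{tt}\langle t,s\rangle\mapsto t$; $\mathsf{ff}\langle t,s\rangle\mapsto s$; $\otimes_{\tau,\rho}ts(\lambda x^\tau,y^\rho.r)\mapsto r[t,s/x,y]$; $\mathsf{nil}_\tau\{t\}s\mapsto s$; $\mathsf{cons}_\tau d a\ell\{t\}s\mapsto t d a(\ell\{t\}s)$ provided $\ell$ is a list. The reduction relation $\to$ is the least relation such that $t\mapsto t'$ implies $t\to t'$, $t\to t'$ implies $ts\to t's$, and $s\to s'$ implies $ts\to ts'$. A term $t$ is normal if there is no $t'$ with $t\to t'$. A typed term is almost closed if all its free variables have type $\Diamond$. -}

module Defs where

open import Data.Nat using (ℕ; zero; suc)
open import Data.Fin using (Fin; zero; suc)
open import Data.Vec using (Vec; []; _∷_; lookup)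
open import Data.Fin.Subset using (Subset; inside; outside; _∈_) renaming (⊥ to ∅)
open import Data.Product using (Σ; _×_)
open import Relation.Binary.PropositionalEquality using (_≡_)
open import Relation.Nullary using (¬_)

infixr 30 _⊸_
infixr 35 _⊗_ _×ₗ_

data Ty : Set where
  ◇    : Ty
  𝔹    : Ty
  _⊸_  : Ty → Ty → Ty
  _⊗_  : Ty → Ty → Ty
  _×ₗ_ : Ty → Ty → Ty
  𝕃    : Ty → Ty

data Const : Set where
  tt ff  : Const
  nil    : Ty → Const
  cons   : Ty → Const
  tensor : Ty → Ty → Const

constTy : Const → Ty
constTy tt = 𝔹
constTy ff = 𝔹
constTy (nil τ) = 𝕃 τ
constTy (cons τ) = ◇ ⊸ τ ⊸ 𝕃 τ ⊸ 𝕃 τ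
constTy (tensor τ ρ) = τ ⊸ ρ ⊸ τ ⊗ ρ

-- Raw terms, de Bruijn style (α-equivalence classes), scoped by n free
-- variable slots.  The types of the variables (x^τ) are given separately by
-- a vector Δ : Vec Ty n; λ binders carry their type annotation.
data Tm (n : ℕ) : Set where
  var  : Fin n → Tm n
  con  : Const → Tm n
  lam  : Ty → Tm (suc n) → Tm n
  pair : Tm n → Tm n → Tm n
  app  : Tm n → Tm n → Tm n
  brc  : Tm n → Tm n

ext : ∀ {m n} → (Fin m → Fin n) → Fin (suc m) → Fin (suc n)
ext ρ zero = zero
ext ρ (suc i) = suc (ρ i)

ren : ∀ {m n} → (Fin m → Fin n) → Tm m → Tm n
ren ρ (var i) = var (ρ i)
ren ρ (con c) = con c
ren ρ (lam τ t) = lam τ (ren (ext ρ) t)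
ren ρ (pair t s) = pair (ren ρ t) (ren ρ s)
ren ρ (app t s) = app (ren ρ t) (ren ρ s)
ren ρ (brc t) = brc (ren ρ t)

exts : ∀ {m n} → (Fin m → Tm n) → Fin (suc m) → Tm (suc n)
exts σ zero = var zero
exts σ (suc i) = ren suc (σ i)

sub : ∀ {m n} → (Fin m → Tm n) → Tm m → Tm n
sub σ (var i) = σ i
sub σ (con c) = con c
sub σ (lam τ t) = lam τ (sub (exts σ) t)
sub σ (pair t s) = pair (sub σ t) (sub σ s)
sub σ (app t s) = app (sub σ t) (sub σ s)
sub σ (brc t) = brc (sub σ t)

σ₁ : ∀ {n} → Tm n → Fin (suc n) → Tm n
σ₁ s zero = s
σ₁ s (suc i) = var i

_[_]₁ : ∀ {n} → Tm (suc n) → Tm n → Tm n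
t [ s ]₁ = sub (σ₁ s) t

-- r [ t , s / x , y ]  for  λ x . λ y . r  (y = index 0, x = index 1)
σ₂ : ∀ {n} → Tm n → Tm n → Fin (suc (suc n)) → Tm n
σ₂ t s zero = s
σ₂ t s (suc zero) = t
σ₂ t s (suc (suc i)) = var i

_[_,_]₂ : ∀ {n} → Tm (suc (suc n)) → Tm n → Tm n → Tm n
r [ t , s ]₂ = sub (σ₂ t s) r

-- Γ = Γ₁ , Γ₂  (disjoint union of contexts, as subsets of the variable slots)
data Split : ∀ {n} → Subset n → Subset n → Subset n → Set where
  []    : Split [] [] []
  left  : ∀ {n} {Γ Γ₁ Γ₂ : Subset n} → Split Γ Γ₁ Γ₂ → Split (inside ∷ Γ) (inside ∷ Γ₁) (outside ∷ Γ₂)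
  right : ∀ {n} {Γ Γ₁ Γ₂ : Subset n} → Split Γ Γ₁ Γ₂ → Split (inside ∷ Γ) (outside ∷ Γ₁) (inside ∷ Γ₂)
  none  : ∀ {n} {Γ Γ₁ Γ₂ : Subset n} → Split Γ Γ₁ Γ₂ → Split (outside ∷ Γ) (outside ∷ Γ₁) (outside ∷ Γ₂)

data _∣_⊢_∶_ : ∀ {n} → Vec Ty n → Subset n → Tm n → Ty → Set where
  ⊢var   : ∀ {n} {Δ : Vec Ty n} {Γ i τ} → i ∈ Γ → lookup Δ i ≡ τ → Δ ∣ Γ ⊢ var i ∶ τ
  ⊢con   : ∀ {n} {Δ : Vec Ty n} {Γ c} → Δ ∣ Γ ⊢ con c ∶ constTy c
  ⊸⁺     : ∀ {n} {Δ : Vec Ty n} {Γ t τ ρ} →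
           (τ ∷ Δ) ∣ (inside ∷ Γ) ⊢ t ∶ ρ → Δ ∣ Γ ⊢ lam τ t ∶ τ ⊸ ρ
  ⊸⁻     : ∀ {n} {Δ : Vec Ty n} {Γ Γ₁ Γ₂ t s τ ρ} → Split Γ Γ₁ Γ₂ →
           Δ ∣ Γ₁ ⊢ t ∶ τ ⊸ ρ → Δ ∣ Γ₂ ⊢ s ∶ τ → Δ ∣ Γ ⊢ app t s ∶ ρ
  ×⁺     : ∀ {n} {Δ : Vec Ty n} {Γ t s τ ρ} →
           Δ ∣ Γ ⊢ t ∶ τ → Δ ∣ Γ ⊢ s ∶ ρ → Δ ∣ Γ ⊢ pair t s ∶ τ ×ₗ ρ
  ×⁻tt   : ∀ {n} {Δ : Vec Ty n} {Γ t τ ρ} →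
           Δ ∣ Γ ⊢ t ∶ τ ×ₗ ρ → Δ ∣ Γ ⊢ app t (con tt) ∶ τ
  ×⁻ff   : ∀ {n} {Δ : Vec Ty n} {Γ t τ ρ} →
           Δ ∣ Γ ⊢ t ∶ τ ×ₗ ρ → Δ ∣ Γ ⊢ app t (con ff) ∶ ρ
  𝔹⁻     : ∀ {n} {Δ : Vec Ty n} {Γ Γ₁ Γ₂ t s r τ} → Split Γ Γ₁ Γ₂ →
           Δ ∣ Γ₁ ⊢ t ∶ 𝔹 → Δ ∣ Γ₂ ⊢ s ∶ τ → Δ ∣ Γ₂ ⊢ r ∶ τ →
           Δ ∣ Γ ⊢ app t (pair s r) ∶ τ
  ⊗⁻     : ∀ {n} {Δ : Vec Ty n} {Γ Γ₁ Γ₂ t s τ ρ σ} → Split Γ Γ₁ Γ₂ →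
           Δ ∣ Γ₁ ⊢ t ∶ τ ⊗ ρ → (ρ ∷ τ ∷ Δ) ∣ (inside ∷ inside ∷ Γ₂) ⊢ s ∶ σ →
           Δ ∣ Γ ⊢ app t (lam τ (lam ρ s)) ∶ σ
  𝕃⁻     : ∀ {n} {Δ : Vec Ty n} {Γ t s τ ρ} →
           Δ ∣ Γ ⊢ t ∶ 𝕃 τ → Δ ∣ ∅ ⊢ s ∶ ◇ ⊸ τ ⊸ ρ ⊸ ρ →
           Δ ∣ Γ ⊢ app t (brc s) ∶ ρ ⊸ ρ

Typable : ∀ {n} → Vec Ty n → Tm n → Ty → Set
Typable {n} Δ t τ = Σ (Subset n) (λ Γ → Δ ∣ Γ ⊢ t ∶ τ)

data IsList {n} (Δ : Vec Ty n) (τ : Ty) : Tm n → Set where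
  nilL  : IsList Δ τ (con (nil τ))
  consL : ∀ {d a ℓ} → Typable Δ d ◇ → Typable Δ a τ → IsList Δ τ ℓ →
          IsList Δ τ (app (app (app (con (cons τ)) d) a) ℓ)

data _∣_↦_ {n} (Δ : Vec Ty n) : Tm n → Tm n → Set where
  β     : ∀ {τ t s} → Δ ∣ app (lam τ t) s ↦ (t [ s ]₁)
  πtt   : ∀ {t s} → Δ ∣ app (pair t s) (con tt) ↦ t
  πff   : ∀ {t s} → Δ ∣ app (pair t s) (con ff) ↦ s
  ifTT  : ∀ {t s} → Δ ∣ app (con tt) (pair t s) ↦ t
  ifFF  : ∀ {t s} → Δ ∣ app (con ff) (pair t s) ↦ s
  ⊗β    : ∀ {τ ρ t s r} →
          Δ ∣ app (app (app (con (tensor τ ρ)) t) s) (lam τ (lam ρ r)) ↦ (r [ t , s ]₂)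
  nilβ  : ∀ {τ t s} → Δ ∣ app (app (con (nil τ)) (brc t)) s ↦ s
  consβ : ∀ {τ d a ℓ t s} → Σ Ty (λ σ → IsList Δ σ ℓ) →
          Δ ∣ app (app (app (app (app (con (cons τ)) d) a) ℓ) (brc t)) s
            ↦ app (app (app t d) a) (app (app ℓ (brc t)) s)

data _∣_⟶_ {n} (Δ : Vec Ty n) : Tm n → Tm n → Set where
  conv : ∀ {t t'} → Δ ∣ t ↦ t' → Δ ∣ t ⟶ t'
  appL : ∀ {t t' s} → Δ ∣ t ⟶ t' → Δ ∣ app t s ⟶ app t' s
  appR : ∀ {t s s'} → Δ ∣ s ⟶ s' → Δ ∣ app t s ⟶ app t s'

Normal : ∀ {n} → Vec Ty n → Tm n → Set
Normal Δ t = ∀ t' → ¬ (Δ ∣ t ⟶ t')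

data _∈FV_ {n} : Fin n → Tm n → Set where
  fvVar   : ∀ {i} → i ∈FV var i
  fvLam   : ∀ {i τ t} → suc i ∈FV t → i ∈FV lam τ t
  fvPairL : ∀ {i t s} → i ∈FV t → i ∈FV pair t s
  fvPairR : ∀ {i t s} → i ∈FV s → i ∈FV pair t s
  fvAppL  : ∀ {i t s} → i ∈FV t → i ∈FV app t s
  fvAppR  : ∀ {i t s} → i ∈FV s → i ∈FV app t s
  fvBrc   : ∀ {i t} → i ∈FV t → i ∈FV brc t

AlmostClosed : ∀ {n} → Vec Ty n → Tm n → Set
AlmostClosed Δ t = ∀ i → i ∈FV t → lookup Δ i ≡ ◇

{-# OPTIONS --safe #-}
-- The statement is strengthened to a canonical-forms lemma at every type,
-- proved by induction on the typing derivation.  At an elimination the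
-- eliminated subterm is canonical at its type, and each canonical form of that
-- type either forms a redex with the eliminator, contradicting normality, or
-- is again canonical (a partial application of cons or ⊗, or an iterator over
-- a list).  Almost-closedness is what rules out eliminations stuck on a
-- variable: the only variables available have type ◇, which has no eliminator.
module Submission where

open import Defs
open import Data.Fin using (Fin)
open import Data.Vec using (Vec; lookup)
open import Data.Fin.Subset using (Subset)
open import Data.Product using (Σ; _×_; _,_)
open import Data.Sum using (_⊎_; inj₁; inj₂)
open import Data.Empty using (⊥-elim)
open import Relation.Nullary using (¬_)
open import Relation.Binary.PropositionalEquality using (_≡_; refl; sym; subst)

-- Reduction does not go under λ, ⟨_,_⟩ or {_}, so the components of these
-- canonical forms are unconstrained.
data Canonical {n} (Δ : Vec Ty n) : Tm n → Ty → Set where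
  var◇     : ∀ {i} → lookup Δ i ≡ ◇ → Canonical Δ (var i) ◇
  true     : Canonical Δ (con tt) 𝔹
  false    : Canonical Δ (con ff) 𝔹
  list     : ∀ {τ ℓ} → IsList Δ τ ℓ → Canonical Δ ℓ (𝕃 τ)
  abs      : ∀ {τ ρ t} → Canonical Δ (lam τ t) (τ ⊸ ρ)
  pair     : ∀ {τ ρ t s} → Canonical Δ (pair t s) (τ ×ₗ ρ)
  cons₀    : ∀ {τ} → Canonical Δ (con (cons τ)) (◇ ⊸ τ ⊸ 𝕃 τ ⊸ 𝕃 τ)
  cons₁    : ∀ {τ d} → Typable Δ d ◇ →
             Canonical Δ (app (con (cons τ)) d) (τ ⊸ 𝕃 τ ⊸ 𝕃 τ)
  cons₂    : ∀ {τ d a} → Typable Δ d ◇ → Typable Δ a τ →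
             Canonical Δ (app (app (con (cons τ)) d) a) (𝕃 τ ⊸ 𝕃 τ)
  tensor₀  : ∀ {τ ρ} → Canonical Δ (con (tensor τ ρ)) (τ ⊸ ρ ⊸ τ ⊗ ρ)
  tensor₁  : ∀ {τ ρ t} → Canonical Δ (app (con (tensor τ ρ)) t) (ρ ⊸ τ ⊗ ρ)
  tensor₂  : ∀ {τ ρ t s} →
             Canonical Δ (app (app (con (tensor τ ρ)) t) s) (τ ⊗ ρ)
  iterator : ∀ {τ ρ ℓ s} → IsList Δ τ ℓ → Canonical Δ (app ℓ (brc s)) (ρ ⊸ ρ)

module _ {n} {Δ : Vec Ty n} where

  AlmostClosed-appˡ : ∀ {t s} → AlmostClosed Δ (app t s) → AlmostClosed Δ t
  AlmostClosed-appˡ ac i i∈t = ac i (fvAppL i∈t)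

  AlmostClosed-appʳ : ∀ {t s} → AlmostClosed Δ (app t s) → AlmostClosed Δ s
  AlmostClosed-appʳ ac i i∈s = ac i (fvAppR i∈s)

  Normal-appˡ : ∀ {t s} → Normal Δ (app t s) → Normal Δ t
  Normal-appˡ nf t' t⟶t' = nf _ (appL t⟶t')

  Normal-appʳ : ∀ {t s} → Normal Δ (app t s) → Normal Δ s
  Normal-appʳ nf s' s⟶s' = nf _ (appR s⟶s')

  redex⇒¬Normal : ∀ {t t'} → Δ ∣ t ↦ t' → ¬ Normal Δ t
  redex⇒¬Normal t↦t' nf = nf _ (conv t↦t')

  normal⇒canonical : ∀ {Γ t σ} → Δ ∣ Γ ⊢ t ∶ σ →
                     AlmostClosed Δ t → Normal Δ t → Canonical Δ t σ
  normal⇒canonical (⊢var {i = i} _ refl) ac nf =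
    subst (Canonical Δ (var i)) (sym i∶◇) (var◇ i∶◇)
    where i∶◇ = ac i fvVar
  normal⇒canonical (⊢con {c = tt})         ac nf = true
  normal⇒canonical (⊢con {c = ff})         ac nf = false
  normal⇒canonical (⊢con {c = nil τ})      ac nf = list nilL
  normal⇒canonical (⊢con {c = cons τ})     ac nf = cons₀
  normal⇒canonical (⊢con {c = tensor τ ρ}) ac nf = tensor₀
  normal⇒canonical (⊸⁺ _)                  ac nf = abs
  normal⇒canonical (×⁺ _ _)                ac nf = pair
  normal⇒canonical (×⁻tt ⊢t) ac nf with normal⇒canonical ⊢t (AlmostClosed-appˡ ac) (Normal-appˡ nf)
  ... | pair = ⊥-elim (redex⇒¬Normal πtt nf)
  normal⇒canonical (×⁻ff ⊢t) ac nf with normal⇒canonical ⊢t (AlmostClosed-appˡ ac) (Normal-appˡ nf)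
  ... | pair = ⊥-elim (redex⇒¬Normal πff nf)
  normal⇒canonical (𝔹⁻ _ ⊢t _ _) ac nf with normal⇒canonical ⊢t (AlmostClosed-appˡ ac) (Normal-appˡ nf)
  ... | true  = ⊥-elim (redex⇒¬Normal ifTT nf)
  ... | false = ⊥-elim (redex⇒¬Normal ifFF nf)
  normal⇒canonical (⊗⁻ _ ⊢t _) ac nf with normal⇒canonical ⊢t (AlmostClosed-appˡ ac) (Normal-appˡ nf)
  ... | tensor₂ = ⊥-elim (redex⇒¬Normal ⊗β nf)
  normal⇒canonical (𝕃⁻ ⊢t _) ac nf with normal⇒canonical ⊢t (AlmostClosed-appˡ ac) (Normal-appˡ nf)
  ... | list isList = iterator isList
  normal⇒canonical (⊸⁻ {Γ₂ = Γ₂} _ ⊢t ⊢s) ac nf with normal⇒canonical ⊢t (AlmostClosed-appˡ ac) (Normal-appˡ nf)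
  ... | abs                         = ⊥-elim (redex⇒¬Normal β nf)
  ... | cons₀                       = cons₁ (Γ₂ , ⊢s)
  ... | cons₁ ⊢d                    = cons₂ ⊢d (Γ₂ , ⊢s)
  ... | tensor₀                     = tensor₁
  ... | tensor₁                     = tensor₂
  ... | iterator nilL               = ⊥-elim (redex⇒¬Normal nilβ nf)
  ... | iterator (consL _ _ isList) = ⊥-elim (redex⇒¬Normal (consβ (_ , isList)) nf)
  ... | cons₂ ⊢d ⊢a with normal⇒canonical ⊢s (AlmostClosed-appʳ ac) (Normal-appʳ nf)
  ...   | list isList = list (consL ⊢d ⊢a isList)

  canonical-𝕃⇒IsList : ∀ {t τ} → Canonical Δ t (𝕃 τ) → IsList Δ τ t
  canonical-𝕃⇒IsList (list isList) = isList

  canonical-𝔹⇒tt⊎ff : ∀ {t} → Canonical Δ t 𝔹 → (t ≡ con tt) ⊎ (t ≡ con ff)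
  canonical-𝔹⇒tt⊎ff true  = inj₁ refl
  canonical-𝔹⇒tt⊎ff false = inj₂ refl

  canonical-◇⇒var : ∀ {t} → Canonical Δ t ◇ →
                    Σ (Fin n) (λ i → (t ≡ var i) × (lookup Δ i ≡ ◇))
  canonical-◇⇒var (var◇ {i} i∶◇) = i , refl , i∶◇

proposition3p6 : ∀ {n} (Δ : Vec Ty n) (Γ : Subset n) (t : Tm n) →
    AlmostClosed Δ t → Normal Δ t →
    ((τ : Ty) → Δ ∣ Γ ⊢ t ∶ 𝕃 τ → IsList Δ τ t)
    × (Δ ∣ Γ ⊢ t ∶ 𝔹 → (t ≡ con tt) ⊎ (t ≡ con ff))
    × (Δ ∣ Γ ⊢ t ∶ ◇ → Σ (Fin n) (λ i → (t ≡ var i) × (lookup Δ i ≡ ◇)))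
proposition3p6 Δ Γ t ac nf =
    (λ τ ⊢t → canonical-𝕃⇒IsList (normal⇒canonical ⊢t ac nf))
  , (λ ⊢t → canonical-𝔹⇒tt⊎ff (normal⇒canonical ⊢t ac nf))
  , (λ ⊢t → canonical-◇⇒var (normal⇒canonical ⊢t ac nf))
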